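{- For every $g \ge 1$ there exists an ordinary graph $G$ cellularly embedded in $\Sigma_g$ that has a complete left walk (for the induced polarization) and satisfies $V(G) = 4\left(1+\frac{1}{3g}\right)^{ -1}$.
   Context: Graphs are finite and connected; ordinary means no loops and no multiple edges. $V(G)=2A/S$ is the average valence, where $A$, $S$ are the numbers of edges and vertices. $\Sigma_g$ is the closed oriented surface of genus $g$; an embedding $G\subset\Sigma_g$ is cellular if the complement is a disjoint union of open 2-cells. The embedding induces a polarization: at each vertex, the oriented edges based there are cyclically ordered counterclockwise; this defines a permutation $\tau$ of oriented edges, $\tau(o,p)=(p,q)$ where $(p,q)$ immediately follows $(p,o)$ in the cyclic order at $p$. Orbits of $\tau$ are left walks; a left walk is complete if it traverses every unoriented edge at least once. -}

module Defs where

open import Data.Nat using (ℕ; zero; suc; _+_; _*_; _≤_)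
open import Data.Fin using (Fin)
open import Data.Bool using (Bool; not)
open import Data.Product using (Σ; ∃; ∃-syntax; _×_; _,_; proj₁; proj₂)
open import Data.Sum using (_⊎_)
open import Relation.Binary.PropositionalEquality using (_≡_; _≢_)
open import Relation.Binary.Construct.Closure.ReflexiveTransitive using (Star)
open import Function using (_∘_)

iter : {X : Set} → (X → X) → ℕ → X → X
iter f zero    x = x
iter f (suc k) x = f (iter f k x)

-- A finite graph with vertex set Fin S and edge set Fin A; edge e joins
-- src e and tgt e.  Oriented edges (darts) are pairs (e , b): b = true
-- means src e → tgt e, b = false means tgt e → src e.
record Graph : Set where
  field
    S   : ℕ
    A   : ℕ
    src : Fin A → Fin S
    tgt : Fin A → Fin S

  Dart : Set
  Dart = Fin A × Bool

  base : Dart → Fin S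
  base (e , Bool.true)  = src e
  base (e , Bool.false) = tgt e

  rev : Dart → Dart
  rev (e , b) = (e , not b)

  Adj : Fin S → Fin S → Set
  Adj u v = ∃[ e ] ((src e ≡ u × tgt e ≡ v) ⊎ (src e ≡ v × tgt e ≡ u))

  Connected : Set
  Connected = ∀ u v → Star Adj u v

  Ordinary : Set
  Ordinary =
    (∀ e → src e ≢ tgt e) ×
    (∀ e e′ → (src e ≡ src e′ × tgt e ≡ tgt e′) ⊎ (src e ≡ tgt e′ × tgt e ≡ src e′) → e ≡ e′)

open Graph public

-- A polarization (rotation system): a permutation σ of the darts that
-- preserves the base point and acts as a single cycle on the darts based
-- at each vertex (σ d = the dart following d counterclockwise at base d).
record Polarization (G : Graph) : Set where
  field
    σ      : Dart G → Dart G
    σ⁻¹    : Dart G → Dart G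
    σσ⁻¹   : ∀ d → σ (σ⁻¹ d) ≡ d
    σ⁻¹σ   : ∀ d → σ⁻¹ (σ d) ≡ d
    σ-base : ∀ d → base G (σ d) ≡ base G d
    σ-cyc  : ∀ d d′ → base G d ≡ base G d′ → ∃[ k ] iter σ k d ≡ d′

  -- τ(o,p) = (p,q) where (p,q) immediately follows (p,o) at p
  τ : Dart G → Dart G
  τ = σ ∘ rev G

  SameWalk : Dart G → Dart G → Set
  SameWalk d d′ = ∃[ k ] iter τ k d ≡ d′

  -- the left walks are exactly F in number: a labelling of darts by Fin F,
  -- surjective, whose fibres are exactly the τ-orbits
  NumLeftWalks : ℕ → Set
  NumLeftWalks F = Σ (Dart G → Fin F) λ lab →
    (∀ i → ∃[ d ] lab d ≡ i) ×
    (∀ d d′ → (lab d ≡ lab d′ → SameWalk d d′) × (SameWalk d d′ → lab d ≡ lab d′))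

  CompleteWalkAt : Dart G → Set
  CompleteWalkAt d = ∀ e → ∃[ k ] proj₁ (iter τ k d) ≡ e

  HasCompleteLeftWalk : Set
  HasCompleteLeftWalk = ∃[ d ] CompleteWalkAt d
open Polarization public

-- Cellular embedding of G in Σ_g (combinatorial model, Heffter–Edmonds):
-- a polarization whose left walks (= faces) number F with S - A + F = 2 - 2g.
record CellularEmbedding (G : Graph) (g : ℕ) : Set where
  field
    pol   : Polarization G
    F     : ℕ
    faces : NumLeftWalks pol F
    euler : S G + F + 2 * g ≡ A G + 2
open CellularEmbedding public

-- Take the wedge, at a common vertex (the hub), of g copies of K₄, each embedded in the torus
-- with one triangular face and one face of length 9 that passes through the hub three times.
-- Interleaving the rotations of the copies at the hub splices their g faces of length 9 into a
-- single face, which runs along every edge, while the g triangles survive.  The result has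
-- 3g + 1 vertices, 6g edges and g + 1 faces: Euler characteristic 2 - 2g, and average valence
-- 12g / (3g + 1).
module Submission where

open import Defs
open import Data.Nat using (ℕ; _+_; _*_; _≤_)
open import Data.Product using (Σ; ∃; _×_)
open import Relation.Binary.PropositionalEquality using (_≡_)

open import Data.Bool using (Bool; true; false; not; if_then_else_)
import Data.Bool.Properties as Bool
open import Data.Empty using (⊥-elim)
open import Data.Fin using (Fin; zero; suc; toℕ; fromℕ; inject₁; punchIn; combine; remQuot)
import Data.Fin.Properties as Fin
open import Data.Nat using (zero; suc; _∸_; z≤n; s≤s)
import Data.Nat.Properties as ℕ
open import Data.Nat.Tactic.RingSolver using (solve-∀)
open import Data.Product using (_,_; proj₁; proj₂; ∃-syntax; map₂′)
import Data.Product.Properties as Product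
open import Data.Sum using (_⊎_; inj₁; inj₂)
open import Function using (_∘_)
open import Relation.Binary using (DecidableEquality)
open import Relation.Binary.Construct.Closure.ReflexiveTransitive using (Star; ε; _◅_; _◅◅_)
open import Relation.Binary.PropositionalEquality
  using (_≢_; refl; sym; trans; cong; cong₂; subst; subst₂; module ≡-Reasoning)
open import Relation.Nullary using (Dec; yes; no)
open import Relation.Nullary.Decidable using (from-yes; map′; ¬?; _→-dec_; _×-dec_; _⊎-dec_)
open import Relation.Unary using (Decidable)

private
  variable
    X Y : Set
    f : X → X
    x y z : X

iter-+ : (f : X → X) (m n : ℕ) (x : X) → iter f (m + n) x ≡ iter f m (iter f n x)
iter-+ f zero    n x = refl
iter-+ f (suc m) n x = cong f (iter-+ f m n x)

iter-conj : (h : X → Y) {f : X → X} {f′ : Y → Y} → (∀ x → f′ (h x) ≡ h (f x)) →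
            ∀ k x → iter f′ k (h x) ≡ h (iter f k x)
iter-conj h comm zero    x = refl
iter-conj h {f′ = f′} comm (suc k) x = trans (cong f′ (iter-conj h comm k x)) (comm _)

iter-invariant : (lab : X → Y) → (∀ x → lab (f x) ≡ lab x) → ∀ k x → lab (iter f k x) ≡ lab x
iter-invariant lab inv zero    x = refl
iter-invariant lab inv (suc k) x = trans (inv _) (iter-invariant lab inv k x)

Reaches : (X → X) → X → X → Set
Reaches f x y = ∃[ k ] iter f k x ≡ y

reaches-refl : Reaches f x x
reaches-refl = 0 , refl

reaches-trans : Reaches f x y → Reaches f y z → Reaches f x z
reaches-trans {f = f} {x = x} (a , refl) (b , refl) = b + a , iter-+ f b a x

reaches-conj : (h : X → Y) {f′ : Y → Y} → (∀ x → f′ (h x) ≡ h (f x)) →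
               Reaches f x y → Reaches f′ (h x) (h y)
reaches-conj h comm (k , refl) = k , iter-conj h comm k _

reaches-through-anchor : {L : Set} (lab : X → L) (anchor : L → X) →
                         (∀ x → Reaches f x (anchor (lab x))) →
                         (∀ x → Reaches f (anchor (lab x)) x) →
                         lab x ≡ lab y → Reaches f x y
reaches-through-anchor {f = f} {y = y} lab anchor to from eq =
  reaches-trans (to _) (subst (λ l → Reaches f (anchor l) y) (sym eq) (from y))

rotate : ∀ {n} → Fin (suc n) → Fin (suc n)
rotate {n} zero    = fromℕ n
rotate     (suc i) = inject₁ i

-- punchIn 1 increments every value except 0, so it preserves the wrap-around from the last
-- element to 0.
rotate⁻¹ : ∀ {n} → Fin (suc n) → Fin (suc n)
rotate⁻¹ {zero}  zero    = zero
rotate⁻¹ {suc n} zero    = suc zero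
rotate⁻¹ {suc n} (suc i) = punchIn (suc zero) (rotate⁻¹ i)

rotate-punchIn₁ : ∀ {n} (i : Fin (suc n)) → rotate (punchIn (suc zero) i) ≡ suc (rotate i)
rotate-punchIn₁ zero    = refl
rotate-punchIn₁ (suc i) = refl

rotate-rotate⁻¹ : ∀ {n} (i : Fin (suc n)) → rotate (rotate⁻¹ i) ≡ i
rotate-rotate⁻¹ {zero}  zero    = refl
rotate-rotate⁻¹ {suc n} zero    = refl
rotate-rotate⁻¹ {suc n} (suc i) = trans (rotate-punchIn₁ (rotate⁻¹ i)) (cong suc (rotate-rotate⁻¹ i))

rotate⁻¹-fromℕ : ∀ n → rotate⁻¹ (fromℕ n) ≡ zero
rotate⁻¹-fromℕ zero    = refl
rotate⁻¹-fromℕ (suc n) = cong (punchIn (suc zero)) (rotate⁻¹-fromℕ n)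

rotate⁻¹-inject₁ : ∀ {n} (i : Fin (suc n)) → rotate⁻¹ (inject₁ i) ≡ suc i
rotate⁻¹-inject₁ zero           = refl
rotate⁻¹-inject₁ {suc n} (suc i) = cong (punchIn (suc zero)) (rotate⁻¹-inject₁ i)

rotate⁻¹-rotate : ∀ {n} (i : Fin (suc n)) → rotate⁻¹ (rotate i) ≡ i
rotate⁻¹-rotate {n}     zero    = rotate⁻¹-fromℕ n
rotate⁻¹-rotate {suc n} (suc i) = rotate⁻¹-inject₁ i

rotate-descends : ∀ {n} k (i j : Fin (suc n)) → toℕ i ≡ k + toℕ j → Reaches rotate i j
rotate-descends zero    i       j eq = 0 , Fin.toℕ-injective eq
rotate-descends (suc k) (suc i) j eq =
  reaches-trans (1 , refl)
    (rotate-descends k (inject₁ i) j (trans (Fin.toℕ-inject₁ i) (ℕ.suc-injective eq)))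

rotate-transitive : ∀ {n} (i j : Fin (suc n)) → Reaches rotate i j
rotate-transitive {n} i j =
  reaches-trans (rotate-descends (toℕ i) i zero (sym (ℕ.+-identityʳ _)))
    (reaches-trans (1 , refl)
      (rotate-descends (n ∸ toℕ j) (fromℕ n) j
        (trans (Fin.toℕ-fromℕ n) (sym (ℕ.m∸n+n≡m (Fin.toℕ≤pred[n] j))))))

reaches-around-cycle : ∀ {n} (h : Fin (suc n) → X) →
                       (∀ i → Reaches f (h i) (h (rotate i))) →
                       ∀ i j → Reaches f (h i) (h j)
reaches-around-cycle {f = f} h step i j =
  let (m , rotations) = rotate-transitive i j
  in subst (Reaches f (h i)) (cong h rotations) (follow m)
  where
  follow : ∀ m → Reaches f (h i) (h (iter rotate m i))
  follow zero    = reaches-refl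
  follow (suc m) = reaches-trans (follow m) (step _)

module Transport
  (G : Graph) {X : Set}
  (enc : X → Dart G) (dec : Dart G → X)
  (enc-dec : ∀ d → enc (dec d) ≡ d) (dec-enc : ∀ x → dec (enc x) ≡ x)
  (s s⁻¹ : X → X) (s-s⁻¹ : ∀ x → s (s⁻¹ x) ≡ x) (s⁻¹-s : ∀ x → s⁻¹ (s x) ≡ x)
  (vertex : X → Fin (S G)) (base-enc : ∀ x → base G (enc x) ≡ vertex x)
  (vertex-s : ∀ x → vertex (s x) ≡ vertex x)
  (s-cyclic : ∀ x y → vertex x ≡ vertex y → Reaches s x y)
  (flip : X → X) (enc-flip : ∀ x → enc (flip x) ≡ rev G (enc x))
  where

  conjugate : (X → X) → Dart G → Dart G
  conjugate f d = enc (f (dec d))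

  conjugate-enc : ∀ f x → conjugate f (enc x) ≡ enc (f x)
  conjugate-enc f x = cong (enc ∘ f) (dec-enc x)

  base-dec : ∀ d → base G d ≡ vertex (dec d)
  base-dec d = trans (cong (base G) (sym (enc-dec d))) (base-enc (dec d))

  reaches-enc : {f : X → X} {f′ : Dart G → Dart G} → (∀ x → f′ (enc x) ≡ enc (f x)) →
                ∀ {d d′} → Reaches f (dec d) (dec d′) → Reaches f′ d d′
  reaches-enc comm reach = subst₂ (Reaches _) (enc-dec _) (enc-dec _) (reaches-conj enc comm reach)

  inverse-conjugate : (f f⁻¹ : X → X) → (∀ x → f (f⁻¹ x) ≡ x) →
                      ∀ d → conjugate f (conjugate f⁻¹ d) ≡ d
  inverse-conjugate f f⁻¹ inv d =
    trans (conjugate-enc f (f⁻¹ (dec d))) (trans (cong enc (inv (dec d))) (enc-dec d))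

  polarization : Polarization G
  polarization = record
    { σ      = conjugate s
    ; σ⁻¹    = conjugate s⁻¹
    ; σσ⁻¹   = inverse-conjugate s s⁻¹ s-s⁻¹
    ; σ⁻¹σ   = inverse-conjugate s⁻¹ s s⁻¹-s
    ; σ-base = λ d → trans (base-enc (s (dec d))) (trans (vertex-s (dec d)) (sym (base-dec d)))
    ; σ-cyc  = λ d d′ eq → reaches-enc (conjugate-enc s)
                 (s-cyclic (dec d) (dec d′) (trans (sym (base-dec d)) (trans eq (base-dec d′))))
    }

  τ-enc : ∀ x → τ polarization (enc x) ≡ enc (s (flip x))
  τ-enc x = trans (cong (conjugate s) (sym (enc-flip x))) (conjugate-enc s (flip x))

  numLeftWalks : {F : ℕ} (face : X → Fin F) (anchor : Fin F → X) →
                 (∀ l → face (anchor l) ≡ l) →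
                 (∀ x → face (s (flip x)) ≡ face x) →
                 (∀ x → Reaches (s ∘ flip) x (anchor (face x))) →
                 (∀ x → Reaches (s ∘ flip) (anchor (face x)) x) →
                 NumLeftWalks polarization F
  numLeftWalks face anchor face-anchor face-τ to-anchor from-anchor =
    face ∘ dec ,
    (λ l → enc (anchor l) , trans (cong face (dec-enc (anchor l))) (face-anchor l)) ,
    λ d d′ → (reaches-enc τ-enc ∘ reaches-through-anchor face anchor to-anchor from-anchor) ,
             λ { (k , refl) → sym (iter-invariant (face ∘ dec) face-dec-τ k d) }
    where
    open ≡-Reasoning
    face-dec-τ : ∀ d → face (dec (τ polarization d)) ≡ face (dec d)
    face-dec-τ d = begin
      face (dec (τ polarization d))             ≡⟨ cong (face ∘ dec ∘ τ polarization) (enc-dec d) ⟨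
      face (dec (τ polarization (enc (dec d)))) ≡⟨ cong (face ∘ dec) (τ-enc (dec d)) ⟩
      face (dec (enc (s (flip (dec d)))))       ≡⟨ cong face (dec-enc _) ⟩
      face (s (flip (dec d)))                   ≡⟨ face-τ (dec d) ⟩
      face (dec d)                              ∎

  completeWalkAt : (x₀ : X) → (∀ e → ∃[ x ] Reaches (s ∘ flip) x₀ x × proj₁ (enc x) ≡ e) →
                   CompleteWalkAt polarization (enc x₀)
  completeWalkAt x₀ covers e =
    let (x , (k , walk) , edge) = covers e
    in k , trans (cong proj₁ (trans (iter-conj enc τ-enc k x₀) (cong enc walk))) edge

K4Dart : Set
K4Dart = Fin 6 × Bool

-- Edge eij runs from local vertex i to local vertex j, and vertex 0 is the hub.  No edge ends at
-- the hub, so k4-tgt⁺ records the target j as j - 1 : Fin 3.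
pattern e01 = zero
pattern e02 = suc zero
pattern e03 = suc (suc zero)
pattern e12 = suc (suc (suc zero))
pattern e23 = suc (suc (suc (suc zero)))
pattern e13 = suc (suc (suc (suc (suc zero))))

k4-src : Fin 6 → Fin 4
k4-src e01 = zero
k4-src e02 = zero
k4-src e03 = zero
k4-src e12 = suc zero
k4-src e23 = suc (suc zero)
k4-src e13 = suc zero

k4-tgt⁺ : Fin 6 → Fin 3
k4-tgt⁺ e01 = zero
k4-tgt⁺ e02 = suc zero
k4-tgt⁺ e03 = suc (suc zero)
k4-tgt⁺ e12 = suc zero
k4-tgt⁺ e23 = suc (suc zero)
k4-tgt⁺ e13 = suc (suc zero)

k4-tgt : Fin 6 → Fin 4
k4-tgt l = suc (k4-tgt⁺ l)

k4-base : K4Dart → Fin 4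
k4-base (l , true)  = k4-src l
k4-base (l , false) = k4-tgt l

-- A rotation system of K₄ with two faces, the triangle marked by k4-triangle and a face of
-- length 9; by Euler's formula it embeds K₄ in the torus.
k4σ : K4Dart → K4Dart
k4σ (e01 , true)  = (e02 , true)
k4σ (e02 , true)  = (e03 , true)
k4σ (e03 , true)  = (e01 , true)
k4σ (e01 , false) = (e12 , true)
k4σ (e12 , true)  = (e13 , true)
k4σ (e13 , true)  = (e01 , false)
k4σ (e02 , false) = (e23 , true)
k4σ (e23 , true)  = (e12 , false)
k4σ (e12 , false) = (e02 , false)
k4σ (e03 , false) = (e13 , false)
k4σ (e13 , false) = (e23 , false)
k4σ (e23 , false) = (e03 , false)

k4σ⁻¹ : K4Dart → K4Dart
k4σ⁻¹ = k4σ ∘ k4σ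

k4τ : K4Dart → K4Dart
k4τ (l , b) = k4σ (l , not b)

k4-triangle : K4Dart → Bool
k4-triangle (e13 , true)  = true
k4-triangle (e23 , false) = true
k4-triangle (e12 , false) = true
k4-triangle _             = false

all-k4-darts? : {P : K4Dart → Set} → Decidable P → Dec (∀ d → P d)
all-k4-darts? P? =
  map′ (λ both → λ { (l , true) → proj₁ (both l) ; (l , false) → proj₂ (both l) })
       (λ all l → all (l , true) , all (l , false))
       (Fin.all? λ l → P? (l , true) ×-dec P? (l , false))

_≟-k4_ : DecidableEquality K4Dart
_≟-k4_ = Product.≡-dec Fin._≟_ Bool._≟_

k4σ-cubed : ∀ d → k4σ (k4σ (k4σ d)) ≡ d
k4σ-cubed = from-yes (all-k4-darts? λ d → k4σ (k4σ (k4σ d)) ≟-k4 d)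

k4-base-σ : ∀ d → k4-base (k4σ d) ≡ k4-base d
k4-base-σ = from-yes (all-k4-darts? λ d → k4-base (k4σ d) Fin.≟ k4-base d)

k4σ-cyclic : ∀ d d′ → k4-base d ≡ k4-base d′ → Σ (Fin 3) λ k → iter k4σ (toℕ k) d ≡ d′
k4σ-cyclic = from-yes (all-k4-darts? λ d → all-k4-darts? λ d′ →
  (k4-base d Fin.≟ k4-base d′) →-dec Fin.any? λ (k : Fin 3) → iter k4σ (toℕ k) d ≟-k4 d′)

k4-triangle-τ : ∀ d → k4-triangle (k4τ d) ≡ k4-triangle d
k4-triangle-τ = from-yes (all-k4-darts? λ d → k4-triangle (k4τ d) Bool.≟ k4-triangle d)

k4-edge-off-triangle : ∀ l → k4-triangle (l , true) ≡ false ⊎ k4-triangle (l , false) ≡ false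
k4-edge-off-triangle = from-yes (Fin.all? λ l →
  (k4-triangle (l , true) Bool.≟ false) ⊎-dec (k4-triangle (l , false) Bool.≟ false))

k4-spoke : ∀ j → Σ (Fin 6) λ l → k4-src l ≡ zero × k4-tgt⁺ l ≡ j
k4-spoke = from-yes (Fin.all? λ j → Fin.any? λ l → (k4-src l Fin.≟ zero) ×-dec (k4-tgt⁺ l Fin.≟ j))

k4-loopless : ∀ l → k4-src l ≢ k4-tgt l
k4-loopless = from-yes (Fin.all? λ l → ¬? (k4-src l Fin.≟ k4-tgt l))

k4-simple : ∀ l l′ → k4-src l ≡ k4-src l′ → k4-tgt⁺ l ≡ k4-tgt⁺ l′ → l ≡ l′
k4-simple = from-yes (Fin.all? λ l → Fin.all? λ l′ →
  (k4-src l Fin.≟ k4-src l′) →-dec (k4-tgt⁺ l Fin.≟ k4-tgt⁺ l′) →-dec (l Fin.≟ l′))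

k4-no-antiparallel : ∀ l l′ → k4-src l ≡ k4-tgt l′ → k4-tgt l ≢ k4-src l′
k4-no-antiparallel = from-yes (Fin.all? λ l → Fin.all? λ l′ →
  (k4-src l Fin.≟ k4-tgt l′) →-dec ¬? (k4-tgt l Fin.≟ k4-src l′))

euler-count : ∀ m → suc (m * 3) + suc m + 2 * m ≡ m * 6 + 2
euler-count = solve-∀

valence-count : ∀ m → 2 * (m * 6) * (3 * m + 1) ≡ 12 * m * suc (m * 3)
valence-count = solve-∀

module Wedge (n : ℕ) where

  g : ℕ
  g = suc n

  WDart : Set
  WDart = Fin g × K4Dart

  -- The only dart whose rotation successor lies in another copy is (e03 , true), whose local
  -- successor is (e01 , true); hub-shift moves that dart to the previous copy.
  hub-shift : WDart → WDart
  hub-shift (i , e01 , true) = (rotate i , e01 , true)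
  hub-shift x                = x

  hub-shift⁻¹ : WDart → WDart
  hub-shift⁻¹ (i , e01 , true) = (rotate⁻¹ i , e01 , true)
  hub-shift⁻¹ x                = x

  hub-shift-hub-shift⁻¹ : ∀ x → hub-shift (hub-shift⁻¹ x) ≡ x
  hub-shift-hub-shift⁻¹ (i , e01 , true)  = cong (λ j → (j , e01 , true)) (rotate-rotate⁻¹ i)
  hub-shift-hub-shift⁻¹ (i , e01 , false) = refl
  hub-shift-hub-shift⁻¹ (i , suc l , b)   = refl

  hub-shift⁻¹-hub-shift : ∀ x → hub-shift⁻¹ (hub-shift x) ≡ x
  hub-shift⁻¹-hub-shift (i , e01 , true)  = cong (λ j → (j , e01 , true)) (rotate⁻¹-rotate i)
  hub-shift⁻¹-hub-shift (i , e01 , false) = refl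
  hub-shift⁻¹-hub-shift (i , suc l , b)   = refl

  hub-shift-off-hub : ∀ i d → k4-base d ≢ zero → hub-shift (i , d) ≡ (i , d)
  hub-shift-off-hub i (e01 , true)  off = ⊥-elim (off refl)
  hub-shift-off-hub i (e01 , false) off = refl
  hub-shift-off-hub i (suc l , b)   off = refl

  wσ : WDart → WDart
  wσ = hub-shift ∘ map₂′ k4σ

  wσ⁻¹ : WDart → WDart
  wσ⁻¹ = map₂′ k4σ⁻¹ ∘ hub-shift⁻¹

  k4σ-cubed-in-copy : ∀ (x : WDart) → map₂′ (k4σ ∘ k4σ ∘ k4σ) x ≡ x
  k4σ-cubed-in-copy (i , d) = cong (i ,_) (k4σ-cubed d)

  wσ-wσ⁻¹ : ∀ x → wσ (wσ⁻¹ x) ≡ x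
  wσ-wσ⁻¹ x = trans (cong hub-shift (k4σ-cubed-in-copy (hub-shift⁻¹ x))) (hub-shift-hub-shift⁻¹ x)

  wσ⁻¹-wσ : ∀ x → wσ⁻¹ (wσ x) ≡ x
  wσ⁻¹-wσ x = trans (cong (map₂′ k4σ⁻¹) (hub-shift⁻¹-hub-shift (map₂′ k4σ x))) (k4σ-cubed-in-copy x)

  wedge-vertex : Fin g → Fin 4 → Fin (suc (g * 3))
  wedge-vertex i zero    = zero
  wedge-vertex i (suc j) = suc (combine i j)

  wedge-vertex-inv : ∀ i i′ v v′ → wedge-vertex i v ≡ wedge-vertex i′ v′ →
                     (v ≡ zero × v′ ≡ zero) ⊎ (i ≡ i′ × v ≡ v′)
  wedge-vertex-inv i i′ zero    zero     eq = inj₁ (refl , refl)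
  wedge-vertex-inv i i′ (suc j) (suc j′) eq =
    let (same-copy , same-local) = Fin.combine-injective i j i′ j′ (Fin.suc-injective eq)
    in inj₂ (same-copy , cong suc same-local)

  wedge-vertex-local : ∀ i i′ v v′ → wedge-vertex i v ≡ wedge-vertex i′ v′ → v ≡ v′
  wedge-vertex-local i i′ v v′ eq with wedge-vertex-inv i i′ v v′ eq
  ... | inj₁ (hub , hub′)      = trans hub (sym hub′)
  ... | inj₂ (_ , same-local) = same-local

  vertex : WDart → Fin (suc (g * 3))
  vertex (i , d) = wedge-vertex i (k4-base d)

  vertex-hub-shift : ∀ x → vertex (hub-shift x) ≡ vertex x
  vertex-hub-shift (i , e01 , true)  = refl
  vertex-hub-shift (i , e01 , false) = refl
  vertex-hub-shift (i , suc l , b)   = refl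

  vertex-wσ : ∀ x → vertex (wσ x) ≡ vertex x
  vertex-wσ (i , d) = trans (vertex-hub-shift (i , k4σ d)) (cong (wedge-vertex i) (k4-base-σ d))

  hub-exit : ∀ i d → k4-base d ≡ zero → Reaches wσ (i , d) (rotate i , e01 , true)
  hub-exit i (e01 , true) _ = 3 , refl
  hub-exit i (e02 , true) _ = 2 , refl
  hub-exit i (e03 , true) _ = 1 , refl
  hub-exit i (e12 , true) ()
  hub-exit i (e23 , true) ()
  hub-exit i (e13 , true) ()
  hub-exit i (l , false)  ()

  hub-entry : ∀ i d → k4-base d ≡ zero → Reaches wσ (i , e01 , true) (i , d)
  hub-entry i (e01 , true) _ = 0 , refl
  hub-entry i (e02 , true) _ = 1 , refl
  hub-entry i (e03 , true) _ = 2 , refl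
  hub-entry i (e12 , true) ()
  hub-entry i (e23 , true) ()
  hub-entry i (e13 , true) ()
  hub-entry i (l , false)  ()

  hub-starts-connected : ∀ i j → Reaches wσ (i , e01 , true) (j , e01 , true)
  hub-starts-connected = reaches-around-cycle (λ j → j , e01 , true) (λ j → 3 , refl)

  hub-darts-connected : ∀ i d i′ d′ → k4-base d ≡ zero → k4-base d′ ≡ zero →
                        Reaches wσ (i , d) (i′ , d′)
  hub-darts-connected i d i′ d′ hub hub′ =
    reaches-trans (hub-exit i d hub)
      (reaches-trans (hub-starts-connected (rotate i) i′) (hub-entry i′ d′ hub′))

  iter-wσ-off-hub : ∀ i d → k4-base d ≢ zero → ∀ k → iter wσ k (i , d) ≡ (i , iter k4σ k d)
  iter-wσ-off-hub i d off zero    = refl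
  iter-wσ-off-hub i d off (suc k) =
    trans (cong wσ (iter-wσ-off-hub i d off k)) (hub-shift-off-hub i (iter k4σ (suc k) d) still-off)
    where
    still-off : k4-base (iter k4σ (suc k) d) ≢ zero
    still-off = off ∘ trans (sym (iter-invariant {f = k4σ} k4-base k4-base-σ (suc k) d))

  wσ-cyclic : ∀ x y → vertex x ≡ vertex y → Reaches wσ x y
  wσ-cyclic (i , d) (i′ , d′) eq with wedge-vertex-inv i i′ (k4-base d) (k4-base d′) eq
  ... | inj₁ (hub , hub′) = hub-darts-connected i d i′ d′ hub hub′
  ... | inj₂ (refl , same) with k4-base d Fin.≟ zero
  ...   | yes hub = hub-darts-connected i d i d′ hub (trans (sym same) hub)
  ...   | no off  = let (k , local) = k4σ-cyclic d d′ same
                    in toℕ k , trans (iter-wσ-off-hub i d off (toℕ k)) (cong (i ,_) local)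

  flip : WDart → WDart
  flip (i , l , b) = (i , l , not b)

  wτ : WDart → WDart
  wτ = wσ ∘ flip

  face : WDart → Fin (suc g)
  face (i , d) = if k4-triangle d then suc i else zero

  face-anchor : Fin (suc g) → WDart
  face-anchor zero    = (zero , e01 , true)
  face-anchor (suc i) = (i , e13 , true)

  face-face-anchor : ∀ l → face (face-anchor l) ≡ l
  face-face-anchor zero    = refl
  face-face-anchor (suc i) = refl

  face-hub-shift : ∀ x → face (hub-shift x) ≡ face x
  face-hub-shift (i , e01 , true)  = refl
  face-hub-shift (i , e01 , false) = refl
  face-hub-shift (i , suc l , b)   = refl

  face-wτ : ∀ x → face (wτ x) ≡ face x
  face-wτ (i , d) =
    trans (face-hub-shift (i , k4τ d)) (cong (if_then suc i else zero) (k4-triangle-τ d))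

  big-face-starts-connected : ∀ i j → Reaches wτ (i , e01 , true) (j , e01 , true)
  big-face-starts-connected = reaches-around-cycle (λ j → j , e01 , true) (λ j → 9 , refl)

  on-big-face : ∀ {i d} → Reaches wτ (i , e01 , true) (i , d) →
                Reaches wτ (i , d) (rotate i , e01 , true) →
                Reaches wτ (i , d) (face-anchor zero) × Reaches wτ (face-anchor zero) (i , d)
  on-big-face {i} into out =
    reaches-trans out (big-face-starts-connected (rotate i) zero) ,
    reaches-trans (big-face-starts-connected zero i) into

  -- The left walk from (i , e01 , true) runs through the nine darts of the big face of copy i in
  -- the order listed below, and then enters copy rotate i.
  face-orbit : ∀ x → Reaches wτ x (face-anchor (face x)) × Reaches wτ (face-anchor (face x)) x
  face-orbit (i , e01 , true)  = on-big-face (0 , refl) (9 , refl)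
  face-orbit (i , e12 , true)  = on-big-face (1 , refl) (8 , refl)
  face-orbit (i , e02 , false) = on-big-face (2 , refl) (7 , refl)
  face-orbit (i , e03 , true)  = on-big-face (3 , refl) (6 , refl)
  face-orbit (i , e13 , false) = on-big-face (4 , refl) (5 , refl)
  face-orbit (i , e01 , false) = on-big-face (5 , refl) (4 , refl)
  face-orbit (i , e02 , true)  = on-big-face (6 , refl) (3 , refl)
  face-orbit (i , e23 , true)  = on-big-face (7 , refl) (2 , refl)
  face-orbit (i , e03 , false) = on-big-face (8 , refl) (1 , refl)
  face-orbit (i , e13 , true)  = (0 , refl) , (0 , refl)
  face-orbit (i , e23 , false) = (2 , refl) , (1 , refl)
  face-orbit (i , e12 , false) = (1 , refl) , (2 , refl)

  big-face-off-triangle : ∀ i d → k4-triangle d ≡ false → Reaches wτ (face-anchor zero) (i , d)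
  big-face-off-triangle i d off =
    subst (λ l → Reaches wτ (face-anchor l) (i , d)) (cong (if_then suc i else zero) off)
          (proj₂ (face-orbit (i , d)))

  copy-of : Fin (g * 6) → Fin g
  copy-of e = proj₁ (remQuot {g} 6 e)

  k4-edge-of : Fin (g * 6) → Fin 6
  k4-edge-of e = proj₂ (remQuot {g} 6 e)

  combine-of : ∀ e → combine (copy-of e) (k4-edge-of e) ≡ e
  combine-of = Fin.combine-remQuot {g} 6

  wedge : Graph
  wedge = record
    { S   = suc (g * 3)
    ; A   = g * 6
    ; src = λ e → wedge-vertex (copy-of e) (k4-src (k4-edge-of e))
    ; tgt = λ e → wedge-vertex (copy-of e) (k4-tgt (k4-edge-of e))
    }

  src-combine : ∀ i l → src wedge (combine i l) ≡ wedge-vertex i (k4-src l)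
  src-combine i l = cong (λ (j , m) → wedge-vertex j (k4-src m)) (Fin.remQuot-combine i l)

  tgt-combine : ∀ i l → tgt wedge (combine i l) ≡ wedge-vertex i (k4-tgt l)
  tgt-combine i l = cong (λ (j , m) → wedge-vertex j (k4-tgt m)) (Fin.remQuot-combine i l)

  spoke : ∀ y → Σ (Fin (g * 6)) λ e → src wedge e ≡ zero × tgt wedge e ≡ suc y
  spoke y =
    let (i , j) = remQuot {g} 3 y
        (l , from-hub , to-j) = k4-spoke j
    in combine i l ,
       trans (src-combine i l) (cong (wedge-vertex i) from-hub) ,
       trans (tgt-combine i l) (cong suc (trans (cong (combine i) to-j) (Fin.combine-remQuot {g} 3 y)))

  wedge-connected : Connected wedge
  wedge-connected u v = to-hub u ◅◅ from-hub v
    where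
    from-hub : ∀ v → Star (Adj wedge) zero v
    from-hub zero    = ε
    from-hub (suc y) = (proj₁ (spoke y) , inj₁ (proj₂ (spoke y))) ◅ ε
    to-hub : ∀ u → Star (Adj wedge) u zero
    to-hub zero    = ε
    to-hub (suc y) = (proj₁ (spoke y) , inj₂ (proj₂ (spoke y))) ◅ ε

  wedge-ordinary : Ordinary wedge
  wedge-ordinary = loopless , simple
    where
    local : ∀ e e′ {v v′} → wedge-vertex (copy-of e) v ≡ wedge-vertex (copy-of e′) v′ → v ≡ v′
    local e e′ = wedge-vertex-local (copy-of e) (copy-of e′) _ _
    loopless : ∀ e → src wedge e ≢ tgt wedge e
    loopless e = k4-loopless (k4-edge-of e) ∘ local e e
    simple : ∀ e e′ → (src wedge e ≡ src wedge e′ × tgt wedge e ≡ tgt wedge e′) ⊎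
                      (src wedge e ≡ tgt wedge e′ × tgt wedge e ≡ src wedge e′) → e ≡ e′
    simple e e′ (inj₁ (same-src , same-tgt)) =
      let (same-copy , same-tgt⁺) = Fin.combine-injective (copy-of e) (k4-tgt⁺ (k4-edge-of e))
                                      (copy-of e′) (k4-tgt⁺ (k4-edge-of e′)) (Fin.suc-injective same-tgt)
          same-edge = k4-simple _ _ (local e e′ same-src) same-tgt⁺
      in trans (sym (combine-of e)) (trans (cong₂ combine same-copy same-edge) (combine-of e′))
    simple e e′ (inj₂ (src≡tgt , tgt≡src)) =
      ⊥-elim (k4-no-antiparallel _ _ (local e e′ src≡tgt) (local e e′ tgt≡src))

  enc : WDart → Dart wedge
  enc (i , l , b) = (combine i l , b)

  dec : Dart wedge → WDart
  dec (e , b) = (copy-of e , k4-edge-of e , b)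

  base-enc : ∀ x → base wedge (enc x) ≡ vertex x
  base-enc (i , l , true)  = src-combine i l
  base-enc (i , l , false) = tgt-combine i l

  open Transport wedge enc dec
    (λ (e , b) → cong (_, b) (combine-of e))
    (λ (i , l , b) → cong (λ (j , m) → (j , m , b)) (Fin.remQuot-combine i l))
    wσ wσ⁻¹ wσ-wσ⁻¹ wσ⁻¹-wσ vertex base-enc vertex-wσ wσ-cyclic flip (λ _ → refl)

  embedding : CellularEmbedding wedge g
  embedding = record
    { pol   = polarization
    ; F     = suc g
    ; faces = numLeftWalks face face-anchor face-face-anchor face-wτ
                (proj₁ ∘ face-orbit) (proj₂ ∘ face-orbit)
    ; euler = euler-count g
    }

  big-face-complete : CompleteWalkAt polarization (enc (face-anchor zero))
  big-face-complete = completeWalkAt (face-anchor zero) covers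
    where
    covers : ∀ e → ∃[ x ] Reaches wτ (face-anchor zero) x × proj₁ (enc x) ≡ e
    covers e with k4-edge-off-triangle (k4-edge-of e)
    ... | inj₁ off = (copy-of e , k4-edge-of e , true)  , big-face-off-triangle _ _ off , combine-of e
    ... | inj₂ off = (copy-of e , k4-edge-of e , false) , big-face-off-triangle _ _ off , combine-of e

proposition5p3 : (g : ℕ) → 1 ≤ g →
    Σ Graph λ G → Connected G × Ordinary G × 1 ≤ S G ×
      Σ (CellularEmbedding G g) λ E →
        HasCompleteLeftWalk (pol E) ×
        2 * A G * (3 * g + 1) ≡ 12 * g * S G
proposition5p3 zero    ()
proposition5p3 (suc n) _ =
  wedge , wedge-connected , wedge-ordinary , s≤s z≤n ,
  embedding , (enc (face-anchor zero) , big-face-complete) , valence-count (suc n)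
  where open Wedge n
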